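{- Let $k\geq 3$ be odd, and let $G_k$ be the graph with vertex set $\{u,w,v_0,v_1,\ldots,v_{3k-1}\}$ and edge set $\{v_0v_1,v_1v_2,\ldots,v_{3k-2}v_{3k-1},v_{3k-1}v_0\}\cup\{uv_i : i\equiv 1 \text{ or } 2 \pmod 3\}\cup\{wv_i : i\equiv 0 \text{ or } 1 \pmod 3\}$ (indices $i\in\{0,\ldots,3k-1\}$). Then $G_k$ is edge-critical: $G_k$ is uniquely 3-colorable and for every edge $e\in E(G_k)$, the graph $G_k-e$ is not uniquely 3-colorable.
   Context: A graph $G$ is uniquely $k$-colorable if its chromatic number is $k$ and $G$ has only one proper $k$-coloring up to permutation of the colors. A uniquely $k$-colorable graph $G$ is edge-critical if $G-e$ is not uniquely $k$-colorable for every edge $e\in E(G)$. -}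

module Defs where

open import Level using (0ℓ)
open import Data.Nat using (ℕ; zero; suc; _+_; _*_; _∸_; _%_; _≤_)
open import Data.Nat.Properties using ()
open import Data.Fin using (Fin; toℕ)
open import Data.Product using (Σ; _×_; _,_; ∃-syntax; proj₁)
open import Data.Sum using (_⊎_)
open import Data.Empty using (⊥)
open import Relation.Nullary using (¬_)
open import Relation.Binary.PropositionalEquality using (_≡_)
open import Function.Bundles using (_↔_; Inverse)

record Graph (V : Set) : Set₁ where
  field
    Adj    : V → V → Set
    sym    : ∀ {x y} → Adj x y → Adj y x
    irrefl : ∀ {x} → ¬ Adj x x
open Graph public

-- An edge of G: an ordered pair of adjacent vertices (xy and yx denote the same edge)
Edge : ∀ {V} → Graph V → Set
Edge {V} G = Σ V λ x → Σ V λ y → Adj G x y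

SamePair : ∀ {V : Set} → V → V → V → V → Set
SamePair a b x y = (a ≡ x × b ≡ y) ⊎ (a ≡ y × b ≡ x)

deleteEdge : ∀ {V} (G : Graph V) → Edge G → Graph V
deleteEdge G (x , y , _) = record
  { Adj    = λ a b → Adj G a b × ¬ SamePair a b x y
  ; sym    = λ { (p , q) → Graph.sym G p , λ { (_⊎_.inj₁ (e1 , e2)) → q (_⊎_.inj₂ (e2 , e1))
                                                ; (_⊎_.inj₂ (e1 , e2)) → q (_⊎_.inj₁ (e2 , e1)) } }
  ; irrefl = λ { (p , _) → Graph.irrefl G p }
  }

ProperColoring : ∀ {V} → Graph V → ℕ → Set
ProperColoring {V} G k = Σ (V → Fin k) λ c → ∀ {x y} → Adj G x y → ¬ (c x ≡ c y)

Colorable : ∀ {V} → Graph V → ℕ → Set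
Colorable G k = ProperColoring G k

ChromaticNumber : ∀ {V} → Graph V → ℕ → Set
ChromaticNumber G k = Colorable G k × (∀ m → suc m ≤ k → ¬ Colorable G m)

UniquelyColorable : ∀ {V} → Graph V → ℕ → Set
UniquelyColorable {V} G k =
  ChromaticNumber G k ×
  ((c d : ProperColoring G k) →
     Σ (Fin k ↔ Fin k) λ π → ∀ (x : V) → Inverse.to π (proj₁ c x) ≡ proj₁ d x)

EdgeCritical : ∀ {V} → Graph V → ℕ → Set
EdgeCritical G k = UniquelyColorable G k × (∀ (e : Edge G) → ¬ UniquelyColorable (deleteEdge G e) k)

data VertexG (k : ℕ) : Set where
  u : VertexG k
  w : VertexG k
  v : Fin (3 * k) → VertexG k

CycleNext : (k : ℕ) → Fin (3 * k) → Fin (3 * k) → Set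
CycleNext k i j = (toℕ j ≡ suc (toℕ i)) ⊎ (toℕ i ≡ 3 * k ∸ 1 × toℕ j ≡ 0)

UAdj : ℕ → Set
UAdj i = (i % 3 ≡ 1) ⊎ (i % 3 ≡ 2)

WAdj : ℕ → Set
WAdj i = (i % 3 ≡ 0) ⊎ (i % 3 ≡ 1)

AdjG : (k : ℕ) → VertexG k → VertexG k → Set
AdjG k (v i) (v j) = CycleNext k i j ⊎ CycleNext k j i
AdjG k u (v i) = UAdj (toℕ i)
AdjG k (v i) u = UAdj (toℕ i)
AdjG k w (v i) = WAdj (toℕ i)
AdjG k (v i) w = WAdj (toℕ i)
AdjG k _ _ = ⊥

private
  open import Data.Nat.Properties using (1+n≢n; m+1+n≢0)
  open import Relation.Binary.PropositionalEquality using (refl; trans) renaming (sym to ≡-sym)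

  cyc-irr : ∀ k → ¬ k ≡ 0 → ∀ i → ¬ CycleNext k i i
  cyc-irr k _ i (_⊎_.inj₁ e) = 1+n≢n (≡-sym e)
  cyc-irr zero nz i (_⊎_.inj₂ _) = nz refl
  cyc-irr (suc k) _ i (_⊎_.inj₂ (a , b)) = m+1+n≢0 k (trans (≡-sym a) b)

  AdjG-sym : ∀ k {x y} → AdjG k x y → AdjG k y x
  AdjG-sym k {u} {v i} p = p
  AdjG-sym k {w} {v i} p = p
  AdjG-sym k {v i} {u} p = p
  AdjG-sym k {v i} {w} p = p
  AdjG-sym k {v i} {v j} (_⊎_.inj₁ p) = _⊎_.inj₂ p
  AdjG-sym k {v i} {v j} (_⊎_.inj₂ p) = _⊎_.inj₁ p

  AdjG-irr : ∀ k → ¬ k ≡ 0 → ∀ {x} → ¬ AdjG k x x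
  AdjG-irr k nz {v i} (_⊎_.inj₁ p) = cyc-irr k nz i p
  AdjG-irr k nz {v i} (_⊎_.inj₂ p) = cyc-irr k nz i p

Gk : (k : ℕ) → 3 ≤ k → Graph (VertexG k)
Gk k h = record { Adj = AdjG k ; sym = AdjG-sym k ; irrefl = AdjG-irr k (nz h) }
  where
    nz : ∀ {k} → 3 ≤ k → ¬ k ≡ 0
    nz {suc _} _ ()

-- The coloring std gives u the color 0, w the color 2 and v_i the color i mod 3. Every proper
-- 3-coloring d is a relabeling of std: d u ≠ d w, because every v_i is adjacent to u or w and
-- an odd cycle is not 2-colorable; then the colors are forced around the cycle (v_i with i ≡ 1
-- sees u and w, with i ≡ 2 it sees u and v_{i-1}, with i ≡ 0 it sees w and v_{i+1}).
-- For every edge xy there is a proper coloring of G_k - xy in which x and y share a color, so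
-- it is not a relabeling of std. For a cycle edge, for uv_i with i ≡ 2 and for wv_i with
-- i ≡ 0, give u and w the color 0 and 2-color the path left by removing that edge, resp. by
-- removing v_i (which gets color 0); for uv_i or wv_i with i ≡ 1, exchange in std the colors
-- of v_{i-1} and v_i, resp. of v_i and v_{i+1}.
module Submission where

open import Defs hiding (sym)
open import Data.Nat using (ℕ; zero; suc; _≤_; _<_; _%_; _*_; _∸_; z≤n; s≤s; s≤s⁻¹; parity)
open import Data.Nat.Properties
  using (_≟_; 1+n≢n; *-suc; suc-injective; m≤n⇒m<n∨m≡n; <-trans; n<1+n; ≤∧≢⇒<; <-irrefl; ≤-reflexive;
         ≤-trans)
open import Data.Parity.Base using (Parity; 0ℙ; 1ℙ; _⁻¹) renaming (_+_ to _ℙ+_)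
import Data.Parity.Properties as ℙ
open import Data.Fin using (Fin; toℕ; fromℕ<; inject≤; punchOut)
open import Data.Fin.Patterns using (0F; 1F; 2F)
open import Data.Fin.Properties
  using (toℕ-injective; toℕ-fromℕ<; toℕ<n; toℕ≤pred[n]; inject≤-injective; punchOut-injective)
import Data.Fin.Properties as Fin
import Data.Fin.Permutation as Perm
open import Data.Product using (Σ; _×_; _,_; proj₁)
open import Data.Sum using (_⊎_; inj₁; inj₂)
open import Data.Empty using (⊥; ⊥-elim)
open import Relation.Nullary using (¬_; Dec; yes; no)
open import Relation.Binary.PropositionalEquality
open import Function.Base using (id; _∘′_; case_of_)
open import Function.Bundles using (_↔_; Inverse; Injection)
open import Function.Properties.Inverse using (↔⇒↣)
open import Function.Construct.Composition using (_↔-∘_)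
open import Function.Construct.Symmetry using (↔-sym)

open Inverse using (to; from)

private
  variable
    V : Set
    m n : ℕ
    G : Graph V
    x y : V

Relabeling : (V → Fin n) → (V → Fin n) → Set
Relabeling {n = n} c d = Σ (Fin n ↔ Fin n) λ π → ∀ x → to π (c x) ≡ d x

relabeling-sym : {c d : V → Fin n} → Relabeling c d → Relabeling d c
relabeling-sym {c = c} {d} (π , π∘c≡d) = ↔-sym π , λ x → begin
  from π (d x)         ≡⟨ cong (from π) (π∘c≡d x) ⟨
  from π (to π (c x))  ≡⟨ Inverse.strictlyInverseʳ π (c x) ⟩
  c x                  ∎
  where open ≡-Reasoning

relabeling-trans : {c d e : V → Fin n} → Relabeling c d → Relabeling d e → Relabeling c e
relabeling-trans (π , π∘c≡d) (ρ , ρ∘d≡e) = ρ ↔-∘ π , λ x → trans (cong (to ρ) (π∘c≡d x)) (ρ∘d≡e x)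

properColoring-weaken : m ≤ n → ProperColoring G m → ProperColoring G n
properColoring-weaken m≤n (c , c-proper) =
  (λ x → inject≤ (c x) m≤n) , λ adj eq → c-proper adj (inject≤-injective _ _ _ _ eq)

properColoring-deleteEdge : (e : Edge G) → ProperColoring G n → ProperColoring (deleteEdge G e) n
properColoring-deleteEdge e (c , c-proper) = c , λ (adj , _) → c-proper adj

samePair-comm : ∀ {a b : V} → SamePair a b x y → SamePair b a x y
samePair-comm (inj₁ (a≡x , b≡y)) = inj₂ (b≡y , a≡x)
samePair-comm (inj₂ (a≡y , b≡x)) = inj₁ (b≡x , a≡y)

samePair-swap : ∀ {a b : V} → SamePair a b x y → SamePair a b y x
samePair-swap (inj₁ p) = inj₂ p
samePair-swap (inj₂ p) = inj₁ p

ProperExcept : Graph V → (V → Fin n) → V → V → Set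
ProperExcept G d x y = ∀ {a b} → Adj G a b → d a ≡ d b → SamePair a b x y

MergingColoring : Graph V → ℕ → V → V → Set
MergingColoring {V} G n x y = Σ (V → Fin n) λ d → d x ≡ d y × ProperExcept G d x y

mergingColoring-sym : MergingColoring G n x y → MergingColoring G n y x
mergingColoring-sym (d , dx≡dy , d-proper) = d , sym dx≡dy , λ adj eq → samePair-swap (d-proper adj eq)

merging⇒¬uniquelyColorable : ProperColoring G n → (xy : Adj G x y) →
                             MergingColoring G n x y → ¬ UniquelyColorable (deleteEdge G (x , y , xy)) n
merging⇒¬uniquelyColorable {G = G} {x = x} {y = y} (c , c-proper) xy (d , dx≡dy , d-proper) (_ , unique)
  with unique (properColoring-deleteEdge {G = G} (x , y , xy) (c , c-proper))
              (d , λ (adj , ¬xy) eq → ¬xy (d-proper adj eq))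
... | π , π∘c≡d = c-proper xy (Injection.injective (↔⇒↣ π) (begin
  to π (c x)  ≡⟨ π∘c≡d x ⟩
  d x         ≡⟨ dx≡dy ⟩
  d y         ≡⟨ π∘c≡d y ⟨
  to π (c y)  ∎))
  where open ≡-Reasoning

≢-others⇒≡ : (π : Fin n ↔ Fin n) {y : Fin n} (t : Fin n) →
             (∀ s → s ≢ t → y ≢ to π s) → y ≡ to π t
≢-others⇒≡ π {y} t y≢others with from π y Fin.≟ t
... | yes π⁻¹y≡t = trans (sym (Inverse.strictlyInverseˡ π y)) (cong (to π) π⁻¹y≡t)
... | no  π⁻¹y≢t = ⊥-elim (y≢others _ π⁻¹y≢t (sym (Inverse.strictlyInverseˡ π y)))

permutation-0F-2F : ∀ {a b : Fin 3} → a ≢ b →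
                    Σ (Fin 3 ↔ Fin 3) λ π → to π 0F ≡ a × to π 2F ≡ b
permutation-0F-2F {0F} {0F} a≢b = ⊥-elim (a≢b refl)
permutation-0F-2F {0F} {1F} _   = Perm.transpose 1F 2F , refl , refl
permutation-0F-2F {0F} {2F} _   = Perm.id , refl , refl
permutation-0F-2F {1F} {0F} _   = Perm.transpose 0F 1F Perm.∘ₚ Perm.transpose 0F 2F , refl , refl
permutation-0F-2F {1F} {1F} a≢b = ⊥-elim (a≢b refl)
permutation-0F-2F {1F} {2F} _   = Perm.transpose 0F 1F , refl , refl
permutation-0F-2F {2F} {0F} _   = Perm.transpose 0F 2F , refl , refl
permutation-0F-2F {2F} {1F} _   = Perm.transpose 0F 2F Perm.∘ₚ Perm.transpose 0F 1F , refl , refl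
permutation-0F-2F {2F} {2F} a≢b = ⊥-elim (a≢b refl)

next : Fin 3 → Fin 3
next 0F = 1F
next 1F = 2F
next 2F = 0F

next-injective : ∀ {a b} → next a ≡ next b → a ≡ b
next-injective {0F} {0F} _ = refl
next-injective {0F} {1F} ()
next-injective {0F} {2F} ()
next-injective {1F} {0F} ()
next-injective {1F} {1F} _ = refl
next-injective {1F} {2F} ()
next-injective {2F} {0F} ()
next-injective {2F} {1F} ()
next-injective {2F} {2F} _ = refl

next≢id : ∀ a → next a ≢ a
next≢id 0F ()
next≢id 1F ()
next≢id 2F ()

mod3 : ℕ → Fin 3
mod3 0 = 0F
mod3 1 = 1F
mod3 2 = 2F
mod3 (suc (suc (suc n))) = mod3 n

toℕ-mod3 : ∀ n → toℕ (mod3 n) ≡ n % 3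
toℕ-mod3 0 = refl
toℕ-mod3 1 = refl
toℕ-mod3 2 = refl
toℕ-mod3 (suc (suc (suc n))) = toℕ-mod3 n

mod3-suc : ∀ n → mod3 (suc n) ≡ next (mod3 n)
mod3-suc 0 = refl
mod3-suc 1 = refl
mod3-suc 2 = refl
mod3-suc (suc (suc (suc n))) = mod3-suc n

mod3-suc-≢ : ∀ n → mod3 n ≢ mod3 (suc n)
mod3-suc-≢ n eq = next≢id (mod3 n) (trans (sym (mod3-suc n)) (sym eq))

mod3[3*k]≡0F : ∀ k → mod3 (3 * k) ≡ 0F
mod3[3*k]≡0F zero    = refl
mod3[3*k]≡0F (suc k) = trans (cong mod3 (*-suc 3 k)) (mod3[3*k]≡0F k)

mod3≡⇒%3≡ : ∀ n {c} → mod3 n ≡ c → n % 3 ≡ toℕ c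
mod3≡⇒%3≡ n eq = trans (sym (toℕ-mod3 n)) (cong toℕ eq)

UAdj⇒mod3≢0F : ∀ n → UAdj n → mod3 n ≢ 0F
UAdj⇒mod3≢0F n (inj₁ n%3≡1) eq with () ← trans (sym n%3≡1) (mod3≡⇒%3≡ n eq)
UAdj⇒mod3≢0F n (inj₂ n%3≡2) eq with () ← trans (sym n%3≡2) (mod3≡⇒%3≡ n eq)

WAdj⇒mod3≢2F : ∀ n → WAdj n → mod3 n ≢ 2F
WAdj⇒mod3≢2F n (inj₁ n%3≡0) eq with () ← trans (sym n%3≡0) (mod3≡⇒%3≡ n eq)
WAdj⇒mod3≢2F n (inj₂ n%3≡1) eq with () ← trans (sym n%3≡1) (mod3≡⇒%3≡ n eq)

mod3≢0F⇒UAdj : ∀ n {c} → mod3 n ≡ c → c ≢ 0F → UAdj n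
mod3≢0F⇒UAdj n {0F} _  c≢0F = ⊥-elim (c≢0F refl)
mod3≢0F⇒UAdj n {1F} eq _    = inj₁ (mod3≡⇒%3≡ n eq)
mod3≢0F⇒UAdj n {2F} eq _    = inj₂ (mod3≡⇒%3≡ n eq)

mod3≢2F⇒WAdj : ∀ n {c} → mod3 n ≡ c → c ≢ 2F → WAdj n
mod3≢2F⇒WAdj n {0F} eq _    = inj₁ (mod3≡⇒%3≡ n eq)
mod3≢2F⇒WAdj n {1F} eq _    = inj₂ (mod3≡⇒%3≡ n eq)
mod3≢2F⇒WAdj n {2F} _  c≢2F = ⊥-elim (c≢2F refl)

swapSuc : ℕ → ℕ → ℕ
swapSuc zero    zero          = 1
swapSuc zero    1             = 0
swapSuc zero    (suc (suc t)) = suc (suc t)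
swapSuc (suc b) zero          = zero
swapSuc (suc b) (suc t)       = suc (swapSuc b t)

swapSuc-left : ∀ b → swapSuc b b ≡ suc b
swapSuc-left zero    = refl
swapSuc-left (suc b) = cong suc (swapSuc-left b)

swapSuc-right : ∀ b → swapSuc b (suc b) ≡ b
swapSuc-right zero    = refl
swapSuc-right (suc b) = cong suc (swapSuc-right b)

swapSuc-other : ∀ b t → t ≢ b → t ≢ suc b → swapSuc b t ≡ t
swapSuc-other zero    zero          t≢b _     = ⊥-elim (t≢b refl)
swapSuc-other zero    1             _   t≢1   = ⊥-elim (t≢1 refl)
swapSuc-other zero    (suc (suc t)) _   _     = refl
swapSuc-other (suc b) zero          _   _     = refl
swapSuc-other (suc b) (suc t)       t≢b t≢1+b =
  cong suc (swapSuc-other b t (t≢b ∘′ cong suc) (t≢1+b ∘′ cong suc))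

-- Consecutive positions stay at distance 1 or 2 after the swap, so their residues differ.
mod3-swapSuc-≢ : ∀ b t → mod3 (swapSuc b t) ≢ mod3 (swapSuc b (suc t))
mod3-swapSuc-≢ zero          zero          ()
mod3-swapSuc-≢ zero          1             ()
mod3-swapSuc-≢ zero          (suc (suc t)) = mod3-suc-≢ (suc (suc t))
mod3-swapSuc-≢ 1             zero          ()
mod3-swapSuc-≢ (suc (suc b)) zero          ()
mod3-swapSuc-≢ (suc b)       (suc t)       eq = mod3-swapSuc-≢ b t (next-injective (begin
  next (mod3 (swapSuc b t))        ≡⟨ mod3-suc (swapSuc b t) ⟨
  mod3 (suc (swapSuc b t))         ≡⟨ eq ⟩
  mod3 (suc (swapSuc b (suc t)))   ≡⟨ mod3-suc (swapSuc b (suc t)) ⟩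
  next (mod3 (swapSuc b (suc t)))  ∎))
  where open ≡-Reasoning

mod3-swapSuc-cases : ∀ b t {c} → mod3 (swapSuc b t) ≡ c →
                     (t ≡ b × mod3 (suc b) ≡ c) ⊎ (t ≡ suc b × mod3 b ≡ c) ⊎ mod3 t ≡ c
mod3-swapSuc-cases b t eq with t ≟ b | t ≟ suc b
... | yes refl | _         = inj₁ (refl , trans (cong mod3 (sym (swapSuc-left b))) eq)
... | no  _    | yes refl  = inj₂ (inj₁ (refl , trans (cong mod3 (sym (swapSuc-right b))) eq))
... | no  t≢b  | no  t≢1+b = inj₂ (inj₂ (trans (cong mod3 (sym (swapSuc-other b t t≢b t≢1+b))) eq))

mod3-swapSuc-other : ∀ b t → mod3 t ≢ mod3 b → mod3 t ≢ mod3 (suc b) → mod3 (swapSuc b t) ≡ mod3 t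
mod3-swapSuc-other b t t≢b t≢1+b =
  cong mod3 (swapSuc-other b t (t≢b ∘′ cong mod3) (t≢1+b ∘′ cong mod3))

%2≡1⇒parity≡1ℙ : ∀ n → n % 2 ≡ 1 → parity n ≡ 1ℙ
%2≡1⇒parity≡1ℙ 1             _      = refl
%2≡1⇒parity≡1ℙ (suc (suc n)) n%2≡1 = %2≡1⇒parity≡1ℙ n n%2≡1

parity-suc : ∀ n → parity (suc n) ≡ parity n ⁻¹
parity-suc n = sym (ℙ.⁻¹-selfInverse (ℙ.suc-homo-⁻¹ n))

≢⇒≡⁻¹ : ∀ {p q : Parity} → p ≢ q → q ≡ p ⁻¹
≢⇒≡⁻¹ {0ℙ} {0ℙ} p≢q = ⊥-elim (p≢q refl)
≢⇒≡⁻¹ {0ℙ} {1ℙ} _   = refl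
≢⇒≡⁻¹ {1ℙ} {0ℙ} _   = refl
≢⇒≡⁻¹ {1ℙ} {1ℙ} p≢q = ⊥-elim (p≢q refl)

⁻¹-distribˡ-+ : ∀ p q → (p ℙ+ q) ⁻¹ ≡ p ⁻¹ ℙ+ q
⁻¹-distribˡ-+ 0ℙ q = refl
⁻¹-distribˡ-+ 1ℙ q = ℙ.⁻¹-involutive q

toParity : Fin 2 → Parity
toParity 0F = 0ℙ
toParity 1F = 1ℙ

toParity-injective : ∀ {a b} → toParity a ≡ toParity b → a ≡ b
toParity-injective {0F} {0F} _ = refl
toParity-injective {0F} {1F} ()
toParity-injective {1F} {0F} ()
toParity-injective {1F} {1F} _ = refl

parityColor : Parity → Fin 3
parityColor 0ℙ = 1F
parityColor 1ℙ = 2F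

parityColor-injective : ∀ {p q} → parityColor p ≡ parityColor q → p ≡ q
parityColor-injective {0ℙ} {0ℙ} _ = refl
parityColor-injective {0ℙ} {1ℙ} ()
parityColor-injective {1ℙ} {0ℙ} ()
parityColor-injective {1ℙ} {1ℙ} _ = refl

parityColor≢0F : ∀ p → parityColor p ≢ 0F
parityColor≢0F 0ℙ ()
parityColor≢0F 1ℙ ()

-- The 2-coloring of the cycle cut open between positions a and a + 1: it alternates at every
-- step except from a to a + 1.
cutParity : ℕ → ℕ → Parity
cutParity zero    zero    = 1ℙ
cutParity zero    (suc t) = parity (suc t)
cutParity (suc a) zero    = 1ℙ
cutParity (suc a) (suc t) = cutParity a t ⁻¹

cutParity-zero : ∀ a → cutParity a 0 ≡ 1ℙ
cutParity-zero zero    = refl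
cutParity-zero (suc a) = refl

cutParity-flip : ∀ a t → t ≢ a → cutParity a (suc t) ≡ cutParity a t ⁻¹
cutParity-flip zero    zero    t≢a = ⊥-elim (t≢a refl)
cutParity-flip zero    (suc t) _   = parity-suc (suc t)
cutParity-flip (suc a) zero    _   = cong _⁻¹ (cutParity-zero a)
cutParity-flip (suc a) (suc t) t≢a = cong _⁻¹ (cutParity-flip a t (t≢a ∘′ cong suc))

cutParity-cut : ∀ a → cutParity a (suc a) ≡ cutParity a a
cutParity-cut zero    = refl
cutParity-cut (suc a) = cong _⁻¹ (cutParity-cut a)

cutParity-diag : ∀ a → cutParity a a ≡ parity a ⁻¹
cutParity-diag zero    = refl
cutParity-diag (suc a) = begin
  cutParity a a ⁻¹   ≡⟨ cong _⁻¹ (cutParity-diag a) ⟩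
  parity a ⁻¹ ⁻¹     ≡⟨ ℙ.⁻¹-involutive (parity a) ⟩
  parity a           ≡⟨ ℙ.suc-homo-⁻¹ a ⟨
  parity (suc a) ⁻¹  ∎
  where open ≡-Reasoning

cutParity-above : ∀ a t → a < t → cutParity a t ≡ parity t
cutParity-above zero    (suc t) _         = refl
cutParity-above (suc a) (suc t) (s≤s a<t) = begin
  cutParity a t ⁻¹  ≡⟨ cong _⁻¹ (cutParity-above a t a<t) ⟩
  parity t ⁻¹       ≡⟨ parity-suc t ⟨
  parity (suc t)    ∎
  where open ≡-Reasoning

punctured : ℕ → ℕ → Fin 3
punctured a t with t ≟ a
... | yes _ = 0F
... | no  _ = parityColor (cutParity a t)

punctured-at : ∀ a → punctured a a ≡ 0F
punctured-at a with a ≟ a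
... | yes _   = refl
... | no  a≢a = ⊥-elim (a≢a refl)

punctured-off : ∀ a t → t ≢ a → punctured a t ≡ parityColor (cutParity a t)
punctured-off a t t≢a with t ≟ a
... | yes t≡a = ⊥-elim (t≢a t≡a)
... | no  _   = refl

punctured≡0F⇒≡ : ∀ a t → punctured a t ≡ 0F → t ≡ a
punctured≡0F⇒≡ a t eq with t ≟ a
... | yes t≡a = t≡a
... | no  _   = ⊥-elim (parityColor≢0F _ eq)

module _ {k : ℕ} where

  coloring : Fin 3 → Fin 3 → (ℕ → Fin 3) → VertexG k → Fin 3
  coloring cu cw f u     = cu
  coloring cu cw f w     = cw
  coloring cu cw f (v i) = f (toℕ i)

  coloring-monochromatic :
    ∀ {cu cw f} (Q : VertexG k → VertexG k → Set) → (∀ {a b} → Q a b → Q b a) →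
    (∀ i → UAdj (toℕ i) → cu ≡ f (toℕ i) → Q u (v i)) →
    (∀ i → WAdj (toℕ i) → cw ≡ f (toℕ i) → Q w (v i)) →
    (∀ {i j} → CycleNext k i j → f (toℕ i) ≡ f (toℕ j) → Q (v i) (v j)) →
    ∀ {a b} → AdjG k a b → coloring cu cw f a ≡ coloring cu cw f b → Q a b
  coloring-monochromatic Q Q-sym Qu Qw Qv {u}   {v i} adj eq        = Qu i adj eq
  coloring-monochromatic Q Q-sym Qu Qw Qv {v i} {u}   adj eq        = Q-sym (Qu i adj (sym eq))
  coloring-monochromatic Q Q-sym Qu Qw Qv {w}   {v i} adj eq        = Qw i adj eq
  coloring-monochromatic Q Q-sym Qu Qw Qv {v i} {w}   adj eq        = Q-sym (Qw i adj (sym eq))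
  coloring-monochromatic Q Q-sym Qu Qw Qv {v i} {v j} (inj₁ i→j) eq = Qv i→j eq
  coloring-monochromatic Q Q-sym Qu Qw Qv {v i} {v j} (inj₂ j→i) eq = Q-sym (Qv j→i (sym eq))

  cycleNext-elim : (P : ℕ → ℕ → Set) → (∀ t → P t (suc t)) → P (3 * k ∸ 1) 0 →
                   ∀ {i j} → CycleNext k i j → P (toℕ i) (toℕ j)
  cycleNext-elim P step wrap (inj₁ j≡1+i)         = subst (P _) (sym j≡1+i) (step _)
  cycleNext-elim P step wrap (inj₂ (i≡L , j≡0)) = subst₂ P (sym i≡L) (sym j≡0) wrap

module _ {k : ℕ} (k≥3 : 3 ≤ k) (k-odd : k % 2 ≡ 1) where

  private
    N : ℕ
    N = 3 * k

    L : ℕ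
    L = N ∸ 1

    Gₖ : Graph (VertexG k)
    Gₖ = Gk k k≥3

    1+L≡N : suc L ≡ N
    1+L≡N = suc[3*k∸1] k≥3
      where
        suc[3*k∸1] : ∀ {k} → 3 ≤ k → suc (3 * k ∸ 1) ≡ 3 * k
        suc[3*k∸1] {suc k} _ = refl

    parity-L : parity L ≡ 0ℙ
    parity-L = begin
      parity L           ≡⟨ ℙ.suc-homo-⁻¹ L ⟨
      parity (suc L) ⁻¹  ≡⟨ cong (λ n → parity n ⁻¹) 1+L≡N ⟩
      parity N ⁻¹        ≡⟨ cong _⁻¹ (trans (ℙ.*-homo-* 3 k) (%2≡1⇒parity≡1ℙ k k-odd)) ⟩
      0ℙ                 ∎
      where open ≡-Reasoning

    mod3-L : mod3 L ≡ 2F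
    mod3-L = next-injective (begin
      next (mod3 L)  ≡⟨ mod3-suc L ⟨
      mod3 (suc L)   ≡⟨ cong mod3 1+L≡N ⟩
      mod3 N         ≡⟨ mod3[3*k]≡0F k ⟩
      0F             ∎)
      where open ≡-Reasoning

  predecessor : ∀ (i : Fin N) → toℕ i ≢ 0 →
                Σ (Fin N) λ j → suc (toℕ j) ≡ toℕ i × CycleNext k j i
  predecessor i i≢0 with toℕ i in i≡
  ... | zero  = ⊥-elim (i≢0 refl)
  ... | suc n = fromℕ< n<N , cong suc (toℕ-fromℕ< n<N) , inj₁ (cong suc (sym (toℕ-fromℕ< n<N)))
    where
      n<N : n < N
      n<N = <-trans (n<1+n n) (subst (_< N) i≡ (toℕ<n i))

  successor : ∀ (i : Fin N) → toℕ i ≢ L →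
              Σ (Fin N) λ j → toℕ j ≡ suc (toℕ i) × CycleNext k i j
  successor i i≢L = fromℕ< 1+i<N , toℕ-fromℕ< 1+i<N , inj₁ (toℕ-fromℕ< 1+i<N)
    where
      1+i<N : suc (toℕ i) < N
      1+i<N = subst (suc (toℕ i) <_) 1+L≡N (s≤s (≤∧≢⇒< (toℕ≤pred[n] i) i≢L))

  cycleNext-functional : ∀ {a b c : Fin N} → CycleNext k a b → CycleNext k a c → b ≡ c
  cycleNext-functional (inj₁ b≡1+a)     (inj₁ c≡1+a)     = toℕ-injective (trans b≡1+a (sym c≡1+a))
  cycleNext-functional (inj₂ (_ , b≡0)) (inj₂ (_ , c≡0)) = toℕ-injective (trans b≡0 (sym c≡0))
  cycleNext-functional {b = b} (inj₁ b≡1+a) (inj₂ (a≡L , _)) =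
    ⊥-elim (<-irrefl (trans (trans b≡1+a (cong suc a≡L)) 1+L≡N) (toℕ<n b))
  cycleNext-functional {c = c} (inj₂ (a≡L , _)) (inj₁ c≡1+a) =
    ⊥-elim (<-irrefl (trans (trans c≡1+a (cong suc a≡L)) 1+L≡N) (toℕ<n c))

  cycleNext-irreflexive : ∀ {i j} → CycleNext k i j → toℕ i ≢ toℕ j
  cycleNext-irreflexive (inj₁ j≡1+i)       i≡j = 1+n≢n (trans (sym j≡1+i) (sym i≡j))
  cycleNext-irreflexive (inj₂ (i≡L , j≡0)) i≡j =
    case trans (sym mod3-L) (cong mod3 (trans (sym i≡L) (trans i≡j j≡0))) of λ ()

  cycle-¬2-colorable : (b : Fin N → Fin 2) → (∀ {i j} → CycleNext k i j → b i ≢ b j) → ⊥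
  cycle-¬2-colorable b b-proper =
    b-proper L→0 (toParity-injective (trans (walk L iL (toℕ-fromℕ< L<N)) (cong (_ℙ+ p i₀) parity-L)))
    where
      L<N : L < N
      L<N = ≤-reflexive 1+L≡N

      i₀ iL : Fin N
      i₀ = fromℕ< (≤-trans (s≤s z≤n) L<N)
      iL = fromℕ< L<N

      L→0 : CycleNext k iL i₀
      L→0 = inj₂ (toℕ-fromℕ< L<N , toℕ-fromℕ< _)

      p : Fin N → Parity
      p i = toParity (b i)

      walk : ∀ n i → toℕ i ≡ n → p i ≡ parity n ℙ+ p i₀
      walk zero    i i≡0   = cong p (toℕ-injective (trans i≡0 (sym (toℕ-fromℕ< _))))
      walk (suc n) i i≡1+n with predecessor i (λ i≡0 → case trans (sym i≡0) i≡1+n of λ ())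
      ... | j , 1+j≡i , j→i = begin
        p i                     ≡⟨ ≢⇒≡⁻¹ (b-proper j→i ∘′ toParity-injective) ⟩
        p j ⁻¹                  ≡⟨ cong _⁻¹ (walk n j (suc-injective (trans 1+j≡i i≡1+n))) ⟩
        (parity n ℙ+ p i₀) ⁻¹   ≡⟨ ⁻¹-distribˡ-+ (parity n) (p i₀) ⟩
        parity n ⁻¹ ℙ+ p i₀     ≡⟨ cong (_ℙ+ p i₀) (parity-suc n) ⟨
        parity (suc n) ℙ+ p i₀  ∎
        where open ≡-Reasoning

  std : VertexG k → Fin 3
  std = coloring 0F 2F mod3

  std-proper : ProperColoring Gₖ 3
  std-proper = std , coloring-monochromatic {k = k} (λ _ _ → ⊥) id
    (λ i adj → UAdj⇒mod3≢0F (toℕ i) adj ∘′ sym)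
    (λ i adj → WAdj⇒mod3≢2F (toℕ i) adj ∘′ sym)
    (cycleNext-elim {k = k} (λ s t → mod3 s ≢ mod3 t) mod3-suc-≢
                            λ L≡0 → case trans (sym mod3-L) L≡0 of λ ())

  ¬2-colorable : ¬ ProperColoring Gₖ 2
  ¬2-colorable (c , c-proper) = cycle-¬2-colorable (c ∘′ v) (c-proper ∘′ inj₁)

  chromaticNumber : ChromaticNumber Gₖ 3
  chromaticNumber =
    std-proper , λ m m<3 → ¬2-colorable ∘′ properColoring-weaken {G = Gₖ} (s≤s⁻¹ m<3)

  module _ {d : VertexG k → Fin 3} (d-proper : ∀ {x y} → AdjG k x y → d x ≢ d y) where

    hubs-distinct : d u ≢ d w
    -- If d u = d w, every v_i avoids that color, so the other two colors 2-color the cycle.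
    hubs-distinct du≡dw = cycle-¬2-colorable (λ i → punchOut (u≢v i)) λ i→j eq →
      d-proper (inj₁ i→j) (punchOut-injective (u≢v _) (u≢v _) eq)
      where
        u≢v : ∀ i → d u ≢ d (v i)
        u≢v i with mod3 (toℕ i) Fin.≟ 0F
        ... | yes ≡0F = λ eq → d-proper (mod3≢2F⇒WAdj (toℕ i) ≡0F λ ()) (trans (sym du≡dw) eq)
        ... | no  ≢0F = d-proper (mod3≢0F⇒UAdj (toℕ i) refl ≢0F)

    module _ (π : Fin 3 ↔ Fin 3) (π0F≡du : to π 0F ≡ d u) (π2F≡dw : to π 2F ≡ d w) where

      ≢π0F : ∀ i → UAdj (toℕ i) → d (v i) ≢ to π 0F
      ≢π0F i adj eq = d-proper adj (sym (trans eq π0F≡du))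

      ≢π2F : ∀ i → WAdj (toℕ i) → d (v i) ≢ to π 2F
      ≢π2F i adj eq = d-proper adj (sym (trans eq π2F≡dw))

      at-1F : ∀ i → mod3 (toℕ i) ≡ 1F → d (v i) ≡ to π 1F
      at-1F i ≡1F = ≢-others⇒≡ π 1F λ
        { 0F _   → ≢π0F i (mod3≢0F⇒UAdj (toℕ i) ≡1F λ ())
        ; 1F ≢1F → ⊥-elim (≢1F refl)
        ; 2F _   → ≢π2F i (mod3≢2F⇒WAdj (toℕ i) ≡1F λ ()) }

      at-2F : ∀ i → mod3 (toℕ i) ≡ 2F → d (v i) ≡ to π 2F
      at-2F i ≡2F with predecessor i (λ i≡0 → case trans (sym ≡2F) (cong mod3 i≡0) of λ ())
      ... | j , 1+j≡i , j→i = ≢-others⇒≡ π 2F λ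
        { 0F _    → ≢π0F i (mod3≢0F⇒UAdj (toℕ i) ≡2F λ ())
        ; 1F _ eq → d-proper (inj₁ j→i) (trans (at-1F j j≡1F) (sym eq))
        ; 2F ≢2F  → ⊥-elim (≢2F refl) }
        where
          j≡1F : mod3 (toℕ j) ≡ 1F
          j≡1F = next-injective (trans (sym (mod3-suc (toℕ j))) (trans (cong mod3 1+j≡i) ≡2F))

      at-0F : ∀ i → mod3 (toℕ i) ≡ 0F → d (v i) ≡ to π 0F
      at-0F i ≡0F
        with successor i (λ i≡L → case trans (sym ≡0F) (trans (cong mod3 i≡L) mod3-L) of λ ())
      ... | j , j≡1+i , i→j = ≢-others⇒≡ π 0F λ
        { 0F ≢0F  → ⊥-elim (≢0F refl)
        ; 1F _ eq → d-proper (inj₁ i→j) (trans eq (sym (at-1F j j≡1F)))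
        ; 2F _    → ≢π2F i (mod3≢2F⇒WAdj (toℕ i) ≡0F λ ()) }
        where
          j≡1F : mod3 (toℕ j) ≡ 1F
          j≡1F = trans (cong mod3 j≡1+i) (trans (mod3-suc (toℕ i)) (cong next ≡0F))

      std-relabels : ∀ x → to π (std x) ≡ d x
      std-relabels u = π0F≡du
      std-relabels w = π2F≡dw
      std-relabels (v i) with mod3 (toℕ i) in ≡c
      ... | 0F = sym (at-0F i ≡c)
      ... | 1F = sym (at-1F i ≡c)
      ... | 2F = sym (at-2F i ≡c)

  relabeling-std : (d : ProperColoring Gₖ 3) → Relabeling std (proj₁ d)
  relabeling-std (d , d-proper) with permutation-0F-2F (hubs-distinct d-proper)
  ... | π , π0F≡du , π2F≡dw = π , std-relabels d-proper π π0F≡du π2F≡dw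

  uniquelyColorable : UniquelyColorable Gₖ 3
  uniquelyColorable =
    chromaticNumber , λ c d → relabeling-trans (relabeling-sym (relabeling-std c)) (relabeling-std d)

  cutParity-monochromatic : ∀ (a : Fin N) {i j} → CycleNext k i j →
                            cutParity (toℕ a) (toℕ i) ≡ cutParity (toℕ a) (toℕ j) → toℕ i ≡ toℕ a
  cutParity-monochromatic a =
    cycleNext-elim {k = k} (λ s t → cutParity (toℕ a) s ≡ cutParity (toℕ a) t → s ≡ toℕ a)
                           step wrap
    where
      step : ∀ t → cutParity (toℕ a) t ≡ cutParity (toℕ a) (suc t) → t ≡ toℕ a
      step t eq with t ≟ toℕ a
      ... | yes t≡a = t≡a
      ... | no  t≢a = ⊥-elim (ℙ.p≢p⁻¹ _ (trans eq (cutParity-flip (toℕ a) t t≢a)))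

      wrap : cutParity (toℕ a) L ≡ cutParity (toℕ a) 0 → L ≡ toℕ a
      wrap eq with m≤n⇒m<n∨m≡n (toℕ≤pred[n] a)
      ... | inj₂ a≡L = sym a≡L
      ... | inj₁ a<L =
        case trans (sym parity-L) (trans (sym (cutParity-above _ L a<L)) (trans eq (cutParity-zero (toℕ a))))
        of λ ()

  cutParity-ends : ∀ {a b} → CycleNext k a b → cutParity (toℕ a) (toℕ a) ≡ cutParity (toℕ a) (toℕ b)
  cutParity-ends =
    cycleNext-elim {k = k} (λ s t → cutParity s s ≡ cutParity s t) (λ t → sym (cutParity-cut t)) (begin
    cutParity L L  ≡⟨ cutParity-diag L ⟩
    parity L ⁻¹    ≡⟨ cong _⁻¹ parity-L ⟩
    1ℙ             ≡⟨ cutParity-zero L ⟨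
    cutParity L 0  ∎)
    where open ≡-Reasoning

  cycleEdge-merging : ∀ {a b} → CycleNext k a b → MergingColoring Gₖ 3 (v a) (v b)
  cycleEdge-merging {a} {b} a→b =
    coloring 0F 0F (parityColor ∘′ cutParity (toℕ a)) ,
    cong parityColor (cutParity-ends a→b) ,
    coloring-monochromatic {k = k} (λ x y → SamePair x y (v a) (v b)) samePair-comm
      (λ _ _ eq → ⊥-elim (parityColor≢0F _ (sym eq)))
      (λ _ _ eq → ⊥-elim (parityColor≢0F _ (sym eq)))
      λ {i} {j} i→j eq →
        let i≡a = toℕ-injective (cutParity-monochromatic a i→j (parityColor-injective eq))
        in  inj₁ (cong v i≡a ,
                  cong v (cycleNext-functional (subst (λ i → CycleNext k i j) i≡a i→j) a→b))

  punctured-cycle : ∀ (a : Fin N) {i j} → CycleNext k i j →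
                    punctured (toℕ a) (toℕ i) ≢ punctured (toℕ a) (toℕ j)
  punctured-cycle a {i} {j} i→j eq = by-cases (toℕ i ≟ toℕ a) (toℕ j ≟ toℕ a)
    where
      by-cases : Dec (toℕ i ≡ toℕ a) → Dec (toℕ j ≡ toℕ a) → ⊥
      by-cases (yes i≡a) (yes j≡a) = cycleNext-irreflexive i→j (trans i≡a (sym j≡a))
      by-cases (yes i≡a) (no  j≢a) = j≢a (punctured≡0F⇒≡ (toℕ a) (toℕ j)
        (trans (sym eq) (trans (cong (punctured (toℕ a)) i≡a) (punctured-at (toℕ a)))))
      by-cases (no  i≢a) (yes j≡a) = i≢a (punctured≡0F⇒≡ (toℕ a) (toℕ i)
        (trans eq (trans (cong (punctured (toℕ a)) j≡a) (punctured-at (toℕ a)))))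
      by-cases (no  i≢a) (no  j≢a) = i≢a (cutParity-monochromatic a i→j (parityColor-injective
        (trans (sym (punctured-off (toℕ a) (toℕ i) i≢a)) (trans eq (punctured-off (toℕ a) (toℕ j) j≢a)))))

  uEdge-merging-2F : ∀ a → mod3 (toℕ a) ≡ 2F → MergingColoring Gₖ 3 u (v a)
  uEdge-merging-2F a ≡2F =
    coloring 0F 0F (punctured (toℕ a)) ,
    sym (punctured-at (toℕ a)) ,
    coloring-monochromatic {k = k} (λ x y → SamePair x y u (v a)) samePair-comm
      (λ i _ eq → inj₁ (refl , cong v (toℕ-injective (punctured≡0F⇒≡ (toℕ a) (toℕ i) (sym eq)))))
      (λ i adj eq → ⊥-elim (WAdj⇒mod3≢2F (toℕ i) adj
                                        (trans (cong mod3 (punctured≡0F⇒≡ (toℕ a) (toℕ i) (sym eq))) ≡2F)))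
      (λ i→j eq → ⊥-elim (punctured-cycle a i→j eq))

  wEdge-merging-0F : ∀ a → mod3 (toℕ a) ≡ 0F → MergingColoring Gₖ 3 w (v a)
  wEdge-merging-0F a ≡0F =
    coloring 0F 0F (punctured (toℕ a)) ,
    sym (punctured-at (toℕ a)) ,
    coloring-monochromatic {k = k} (λ x y → SamePair x y w (v a)) samePair-comm
      (λ i adj eq → ⊥-elim (UAdj⇒mod3≢0F (toℕ i) adj
                                        (trans (cong mod3 (punctured≡0F⇒≡ (toℕ a) (toℕ i) (sym eq))) ≡0F)))
      (λ i _ eq → inj₁ (refl , cong v (toℕ-injective (punctured≡0F⇒≡ (toℕ a) (toℕ i) (sym eq)))))
      (λ i→j eq → ⊥-elim (punctured-cycle a i→j eq))

  swapped-cycle : ∀ b → mod3 (swapSuc b L) ≢ mod3 (swapSuc b 0) →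
                  ∀ {i j} → CycleNext k i j → mod3 (swapSuc b (toℕ i)) ≢ mod3 (swapSuc b (toℕ j))
  swapped-cycle b =
    cycleNext-elim {k = k} (λ s t → mod3 (swapSuc b s) ≢ mod3 (swapSuc b t)) (mod3-swapSuc-≢ b)

  uEdge-merging-1F : ∀ a → mod3 (toℕ a) ≡ 1F → MergingColoring Gₖ 3 u (v a)
  uEdge-merging-1F a ≡1F with predecessor a (λ a≡0 → case trans (sym ≡1F) (cong mod3 a≡0) of λ ())
  ... | a₋ , 1+b≡a , _ =
    coloring 0F 2F (mod3 ∘′ swapSuc b) ,
    sym (begin
      mod3 (swapSuc b (toℕ a))  ≡⟨ cong (mod3 ∘′ swapSuc b) (sym 1+b≡a) ⟩
      mod3 (swapSuc b (suc b))  ≡⟨ cong mod3 (swapSuc-right b) ⟩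
      mod3 b                    ≡⟨ b≡0F ⟩
      0F                        ∎) ,
    coloring-monochromatic {k = k} (λ x y → SamePair x y u (v a)) samePair-comm onU onW
      (λ i→j eq → ⊥-elim (swapped-cycle b wrap i→j eq))
    where
      open ≡-Reasoning

      b : ℕ
      b = toℕ a₋

      1+b≡1F : mod3 (suc b) ≡ 1F
      1+b≡1F = trans (cong mod3 1+b≡a) ≡1F

      b≡0F : mod3 b ≡ 0F
      b≡0F = next-injective (trans (sym (mod3-suc b)) 1+b≡1F)

      onU : ∀ i → UAdj (toℕ i) → 0F ≡ mod3 (swapSuc b (toℕ i)) → SamePair u (v i) u (v a)
      onU i adj eq with mod3-swapSuc-cases b (toℕ i) (sym eq)
      ... | inj₁ (_ , 1+b≡0F)       = case trans (sym 1+b≡1F) 1+b≡0F of λ ()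
      ... | inj₂ (inj₁ (i≡1+b , _)) = inj₁ (refl , cong v (toℕ-injective (trans i≡1+b 1+b≡a)))
      ... | inj₂ (inj₂ i≡0F)        = ⊥-elim (UAdj⇒mod3≢0F (toℕ i) adj i≡0F)

      onW : ∀ i → WAdj (toℕ i) → 2F ≡ mod3 (swapSuc b (toℕ i)) → SamePair w (v i) u (v a)
      onW i adj eq with mod3-swapSuc-cases b (toℕ i) (sym eq)
      ... | inj₁ (_ , 1+b≡2F)       = case trans (sym 1+b≡1F) 1+b≡2F of λ ()
      ... | inj₂ (inj₁ (_ , b≡2F))  = case trans (sym b≡0F) b≡2F of λ ()
      ... | inj₂ (inj₂ i≡2F)        = ⊥-elim (WAdj⇒mod3≢2F (toℕ i) adj i≡2F)

      L-fixed : mod3 (swapSuc b L) ≡ 2F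
      L-fixed = trans (mod3-swapSuc-other b L (λ L≡b → case trans (sym mod3-L) (trans L≡b b≡0F) of λ ())
                                              (λ L≡1+b → case trans (sym mod3-L) (trans L≡1+b 1+b≡1F) of λ ()))
                      mod3-L

      wrap : mod3 (swapSuc b L) ≢ mod3 (swapSuc b 0)
      wrap eq with mod3-swapSuc-cases b 0 (trans (sym eq) L-fixed)
      ... | inj₁ (_ , 1+b≡2F)      = case trans (sym 1+b≡1F) 1+b≡2F of λ ()
      ... | inj₂ (inj₁ (_ , b≡2F)) = case trans (sym b≡0F) b≡2F of λ ()
      ... | inj₂ (inj₂ ())

  wEdge-merging-1F : ∀ a → mod3 (toℕ a) ≡ 1F → MergingColoring Gₖ 3 w (v a)
  wEdge-merging-1F a ≡1F =
    coloring 0F 2F (mod3 ∘′ swapSuc b) ,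
    sym (trans (cong mod3 (swapSuc-left b)) 1+b≡2F) ,
    coloring-monochromatic {k = k} (λ x y → SamePair x y w (v a)) samePair-comm onU onW
      (λ i→j eq → ⊥-elim (swapped-cycle b wrap i→j eq))
    where
      b : ℕ
      b = toℕ a

      1+b≡2F : mod3 (suc b) ≡ 2F
      1+b≡2F = trans (mod3-suc b) (cong next ≡1F)

      onU : ∀ i → UAdj (toℕ i) → 0F ≡ mod3 (swapSuc b (toℕ i)) → SamePair u (v i) w (v a)
      onU i adj eq with mod3-swapSuc-cases b (toℕ i) (sym eq)
      ... | inj₁ (_ , 1+b≡0F)      = case trans (sym 1+b≡2F) 1+b≡0F of λ ()
      ... | inj₂ (inj₁ (_ , b≡0F)) = case trans (sym ≡1F) b≡0F of λ ()
      ... | inj₂ (inj₂ i≡0F)       = ⊥-elim (UAdj⇒mod3≢0F (toℕ i) adj i≡0F)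

      onW : ∀ i → WAdj (toℕ i) → 2F ≡ mod3 (swapSuc b (toℕ i)) → SamePair w (v i) w (v a)
      onW i adj eq with mod3-swapSuc-cases b (toℕ i) (sym eq)
      ... | inj₁ (i≡b , _)         = inj₁ (refl , cong v (toℕ-injective i≡b))
      ... | inj₂ (inj₁ (_ , b≡2F)) = case trans (sym ≡1F) b≡2F of λ ()
      ... | inj₂ (inj₂ i≡2F)       = ⊥-elim (WAdj⇒mod3≢2F (toℕ i) adj i≡2F)

      0-fixed : mod3 (swapSuc b 0) ≡ 0F
      0-fixed = mod3-swapSuc-other b 0 (λ 0≡b → case trans 0≡b ≡1F of λ ())
                                       (λ 0≡1+b → case trans 0≡1+b 1+b≡2F of λ ())

      wrap : mod3 (swapSuc b L) ≢ mod3 (swapSuc b 0)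
      wrap eq with mod3-swapSuc-cases b L (trans eq 0-fixed)
      ... | inj₁ (_ , 1+b≡0F)      = case trans (sym 1+b≡2F) 1+b≡0F of λ ()
      ... | inj₂ (inj₁ (_ , b≡0F)) = case trans (sym ≡1F) b≡0F of λ ()
      ... | inj₂ (inj₂ L≡0F)       = case trans (sym mod3-L) L≡0F of λ ()

  uEdge-merging : ∀ a → UAdj (toℕ a) → MergingColoring Gₖ 3 u (v a)
  uEdge-merging a adj with mod3 (toℕ a) in ≡c
  ... | 0F = ⊥-elim (UAdj⇒mod3≢0F (toℕ a) adj ≡c)
  ... | 1F = uEdge-merging-1F a ≡c
  ... | 2F = uEdge-merging-2F a ≡c

  wEdge-merging : ∀ a → WAdj (toℕ a) → MergingColoring Gₖ 3 w (v a)
  wEdge-merging a adj with mod3 (toℕ a) in ≡c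
  ... | 0F = wEdge-merging-0F a ≡c
  ... | 1F = wEdge-merging-1F a ≡c
  ... | 2F = ⊥-elim (WAdj⇒mod3≢2F (toℕ a) adj ≡c)

  merging : ∀ {x y} → AdjG k x y → MergingColoring Gₖ 3 x y
  merging {u}   {v a} adj        = uEdge-merging a adj
  merging {v a} {u}   adj        = mergingColoring-sym {G = Gₖ} (uEdge-merging a adj)
  merging {w}   {v a} adj        = wEdge-merging a adj
  merging {v a} {w}   adj        = mergingColoring-sym {G = Gₖ} (wEdge-merging a adj)
  merging {v a} {v b} (inj₁ a→b) = cycleEdge-merging a→b
  merging {v a} {v b} (inj₂ b→a) = mergingColoring-sym {G = Gₖ} (cycleEdge-merging b→a)

theorem3p2 : (k : ℕ) (h : 3 ≤ k) → k % 2 ≡ 1 → EdgeCritical (Gk k h) 3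
theorem3p2 k k≥3 k-odd =
  uniquelyColorable k≥3 k-odd ,
  λ (_ , _ , xy) →
    merging⇒¬uniquelyColorable {G = Gk k k≥3} (std-proper k≥3 k-odd) xy (merging k≥3 k-odd xy)
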